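{- Let $V$ be a finite set, $v\in V$, and let $\epsilon:\binom{V}{2}\to\{ -1,0,1\}$ be a map with $\epsilon(i,v)\ge0$ for all $i\in V\setminus\{v\}$. Define $\epsilon':\binom{V}{2}\to\{ -1,0,1\}$ by $\epsilon'(i,v)=\epsilon(i,v)-1$ for $i\in V\setminus\{v\}$ and $\epsilon'(i,j)=\epsilon(i,j)$ for $i,j\in V\setminus\{v\}$. Then $\Gamma(\epsilon)$ is signed-eliminable if and only if $\Gamma(\epsilon')$ is signed-eliminable.
   Context: A signed graph is a triple $\Gamma=(V_\Gamma,E^+_\Gamma,E^-_\Gamma)$ with $V_\Gamma$ finite and $E^+_\Gamma,E^-_\Gamma$ disjoint sets of unordered pairs of distinct vertices. For a map $\epsilon:\binom{V}{2}\to\{ -1,0,1\}$ (written $\epsilon(i,j)=\epsilon(j,i)$), $\Gamma(\epsilon)$ is the signed graph on $V$ with $E^+=\{\{i,j\}:\epsilon(i,j)=1\}$ and $E^-=\{\{i,j\}:\epsilon(i,j)=-1\}$. A signed graph $\Gamma$ is signed-eliminable if there is a bijective ordering $\nu:V_\Gamma\to[1,|V_\Gamma|]$ such that for every three distinct vertices $i,j,k$ with $\nu(i)<\nu(k)$ and $\nu(j)<\nu(k)$: (i) for $\sigma\in\{+,-\}$, if $\{i,k\}\in E^\sigma$ and $\{j,k\}\in E^\sigma$ then $\{i,j\}\in E^\sigma$; (ii) for $\sigma\in\{+,-\}$, if $\{k,i\}\in E^\sigma$ and $\{i,j\}\in E^{ -\sigma}$ then $\{k,j\}\in E^{ -\sigma}$.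 -}

module Defs where

open import Data.Nat using (ℕ)
open import Data.Fin using (Fin; _<_; _≟_)
open import Data.Product using (_×_; ∃)
open import Relation.Binary.PropositionalEquality using (_≡_)
open import Relation.Nullary using (¬_; yes; no)
open import Function.Definitions using (Bijective)

data Sign : Set where
  minus zer plus : Sign

data PM : Set where
  + - : PM

neg : PM → PM
neg + = -
neg - = +

toSign : PM → Sign
toSign + = plus
toSign - = minus

-- subtract one (only meaningful on {0,1}; the hypothesis ε(i,v) ≥ 0 is assumed)
dec : Sign → Sign
dec plus  = zer
dec zer   = minus
dec minus = minus

-- vertex set V = Fin n; a map ε : (V choose 2) → {-1,0,1} is a function
-- Fin n → Fin n → Sign, required to be symmetric; its diagonal is irrelevant.
Symmetric : ∀ {n} → (Fin n → Fin n → Sign) → Set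
Symmetric ε = ∀ i j → ε i j ≡ ε j i

Edge : ∀ {n} → (Fin n → Fin n → Sign) → PM → Fin n → Fin n → Set
Edge ε σ i j = ε i j ≡ toSign σ

lowerAt : ∀ {n} → Fin n → (Fin n → Fin n → Sign) → (Fin n → Fin n → Sign)
lowerAt v ε i j with i ≟ v | j ≟ v
... | yes _ | yes _ = ε i j
... | yes _ | no _  = dec (ε i j)
... | no _  | yes _ = dec (ε i j)
... | no _  | no _  = ε i j

-- ν is an elimination ordering (bijection V → [1,|V|], here Fin n → Fin n)
IsSignedElimOrdering : ∀ {n} → (Fin n → Fin n → Sign) → (Fin n → Fin n) → Set
IsSignedElimOrdering {n} ε ν =
  Bijective _≡_ _≡_ ν ×
  (∀ (i j k : Fin n) → ¬ i ≡ j → ¬ i ≡ k → ¬ j ≡ k →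
     ν i < ν k → ν j < ν k →
     (∀ σ → Edge ε σ i k → Edge ε σ j k → Edge ε σ i j) ×
     (∀ σ → Edge ε σ k i → Edge ε (neg σ) i j → Edge ε (neg σ) k j))

SignedEliminable : ∀ {n} → (Fin n → Fin n → Sign) → Set
SignedEliminable {n} ε = ∃ λ (ν : Fin n → Fin n) → IsSignedElimOrdering ε ν

{-# OPTIONS --safe #-}

-- Lowering the signs at v cannot break the elimination condition at any vertex w ≠ v: in a
-- triangle the two edges at v only move from + to 0 or from 0 to −, and the condition at w
-- survives this. It therefore suffices to eliminate Γ(ε) so that v goes
-- last, and this is possible: as long as v has no negative edge, some vertex other than v is
-- simplicial, by a signed version of Dirac's lemma applied to the clique {v}. For the converse,
-- the opposite of ε′ again has no negative edge at v, and lowering it at v gives the opposite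
-- of ε; since negating all signs preserves elimination orderings, the forward direction applies.

module Submission where

open import Defs
open import Data.Nat as ℕ using (ℕ; zero; suc)
import Data.Nat.Properties as ℕ
open import Data.Fin as Fin using (Fin; toℕ; fromℕ<; _≟_)
open import Data.Fin.Properties using (toℕ-injective; toℕ-fromℕ<; toℕ<n; any?)
open import Data.Fin.Subset using (Subset; _∈_; _∉_; _⊆_; ⊤; Empty) renaming (_-_ to _∖_)
open import Data.Fin.Subset.Properties
  using (_∈?_; x∈p∧x≢y⇒x∈p-y; p─q⊆p; p─x─y≡p─y─x; ⊆-antisym; ∈⊤)
open import Data.Vec using (_∷_; tabulate; there)
open import Data.Vec.Properties using (lookup∘tabulate; []=⇒lookup; lookup⇒[]=)
open import Data.Bool.Properties using (T-≡)
open import Data.Product using (_×_; _,_; ∃; proj₁; proj₂)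
open import Data.Sum using (inj₁; inj₂)
open import Data.Empty using (⊥-elim)
open import Function using (_∘_; _∘₂_)
open import Function.Bundles using (_⇔_; mk⇔; Equivalence)
open import Level using (0ℓ)
open import Relation.Binary.PropositionalEquality
open import Relation.Nullary using (¬_; Dec; yes; no; contradiction)
open import Relation.Nullary.Decidable using (_×-dec_; ¬?)
open import Relation.Unary using (Pred; Decidable)

SignMap : ℕ → Set
SignMap n = Fin n → Fin n → Sign

variable
  n m : ℕ
  ε ε′ : SignMap n
  S : Subset n
  i j k v w x : Fin n
  σ : PM
  a b c : Sign

opposite : Sign → Sign
opposite minus = plus
opposite zer   = zer
opposite plus  = minus

opposite-involutive : ∀ a → opposite (opposite a) ≡ a
opposite-involutive minus = refl
opposite-involutive zer   = refl
opposite-involutive plus  = refl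

opposite⁻ : ∀ σ → opposite a ≡ toSign σ → a ≡ toSign (neg σ)
opposite⁻ {minus} + refl = refl
opposite⁻ {plus}  - refl = refl

opposite⁺ : ∀ σ → a ≡ toSign (neg σ) → opposite a ≡ toSign σ
opposite⁺ + refl = refl
opposite⁺ - refl = refl

dec≢plus : dec a ≢ plus
dec≢plus {plus}  ()
dec≢plus {zer}   ()
dec≢plus {minus} ()

dec≡minus⁺ : a ≢ plus → dec a ≡ minus
dec≡minus⁺ {plus}  a≢plus = contradiction refl a≢plus
dec≡minus⁺ {zer}   _      = refl
dec≡minus⁺ {minus} _      = refl

dec≡minus⁻ : dec a ≡ minus → a ≢ plus
dec≡minus⁻ () refl

≟plus : ∀ a → Dec (a ≡ plus)
≟plus plus  = yes refl
≟plus zer   = no λ ()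
≟plus minus = no λ ()

record ElimCondition (ε : SignMap n) (i j k : Fin n) : Set where
  constructor _,_
  field
    closure : ∀ σ → Edge ε σ i k → Edge ε σ j k → Edge ε σ i j
    balance : ∀ σ → Edge ε σ k i → Edge ε (neg σ) i j → Edge ε (neg σ) k j

open ElimCondition

Simplicial : SignMap n → Subset n → Fin n → Set
Simplicial ε S w = ∀ {i j} → i ∈ S → j ∈ S → i ≢ j → i ≢ w → j ≢ w → ElimCondition ε i j w

Simplicial-⊆ : ∀ {S′} → S′ ⊆ S → Simplicial ε S w → Simplicial ε S′ w
Simplicial-⊆ S′⊆S w-simp i∈S′ j∈S′ = w-simp (S′⊆S i∈S′) (S′⊆S j∈S′)

condition-cong : (∀ i j → ε i j ≡ ε′ i j) → ElimCondition ε i j k → ElimCondition ε′ i j k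
condition-cong {ε = ε} {ε′ = ε′} {i} {j} {k} ε≗ε′ (c₁ , c₂) =
  (λ σ p q → trans (sym (ε≗ε′ i j)) (c₁ σ (trans (ε≗ε′ i k) p) (trans (ε≗ε′ j k) q))) ,
  (λ σ p q → trans (sym (ε≗ε′ k j)) (c₂ σ (trans (ε≗ε′ k i) p) (trans (ε≗ε′ i j) q)))

condition-opposite : ElimCondition ε i j k → ElimCondition (opposite ∘₂ ε) i j k
condition-opposite (c₁ , c₂) =
  (λ σ p q → opposite⁺ σ (c₁ (neg σ) (opposite⁻ σ p) (opposite⁻ σ q))) ,
  λ { + p q → opposite⁺ - (c₂ - (opposite⁻ + p) (opposite⁻ - q))
    ; - p q → opposite⁺ + (c₂ + (opposite⁻ - p) (opposite⁻ + q)) }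

Triangle : Sign → Sign → Sign → Set
Triangle ij ik jk =
  (∀ σ → ik ≡ toSign σ → jk ≡ toSign σ → ij ≡ toSign σ) ×
  (∀ σ → ik ≡ toSign σ → ij ≡ toSign (neg σ) → jk ≡ toSign (neg σ))

Triangle-cong : ∀ {a′ b′ c′} → a ≡ a′ → b ≡ b′ → c ≡ c′ → Triangle a b c → Triangle a′ b′ c′
Triangle-cong refl refl refl t = t

condition⇒triangle : Symmetric ε → ElimCondition ε i j k → Triangle (ε i j) (ε i k) (ε j k)
condition⇒triangle {ε = ε} {i} {j} {k} ε-sym (c₁ , c₂) =
  c₁ , λ σ p q → trans (ε-sym j k) (c₂ σ (trans (ε-sym k i) p) q)

triangle⇒condition : Symmetric ε → Triangle (ε i j) (ε i k) (ε j k) → ElimCondition ε i j k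
triangle⇒condition {ε = ε} {i} {j} {k} ε-sym (t₁ , t₂) =
  t₁ , λ σ p q → trans (ε-sym k j) (t₂ σ (trans (ε-sym i k) p) q)

-- Lowering the edges at i of a triangle ijk keeps the condition at apex k, for both orders of i, j.
lower-triangle : Triangle a b c → Triangle a c b → Triangle (dec a) (dec b) c × Triangle (dec a) c (dec b)
lower-triangle {a} {b} {c} (t₁ , _) (_ , u₂) =
  ((λ { + p _ → contradiction p dec≢plus ; - p q → apex-negative q p })
  , λ { + p _ → contradiction p dec≢plus ; - _ q → contradiction q dec≢plus }) ,
  ((λ { + _ q → contradiction q dec≢plus ; - p q → apex-negative p q })
  , λ { + p q → dec≡minus⁺ (λ b≡plus → dec≡minus⁻ q (t₁ + b≡plus p))
      ; - _ q → contradiction q dec≢plus })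
  where
    apex-negative : c ≡ minus → dec b ≡ minus → dec a ≡ minus
    apex-negative c≡minus db≡minus = dec≡minus⁺ (dec≡minus⁻ db≡minus ∘ u₂ - c≡minus)

data Elimination (ε : SignMap n) : Subset n → ℕ → Set where
  done : Empty S → Elimination ε S zero
  step : w ∈ S → Simplicial ε S w → Elimination ε (S ∖ w) m → Elimination ε S (suc m)

x∉p∖x : ∀ (p : Subset n) x → x ∉ p ∖ x
x∉p∖x (_ ∷ p) Fin.zero    ()
x∉p∖x (_ ∷ p) (Fin.suc x) (there x∈p∖x) = x∉p∖x p x x∈p∖x

x∈p∖y⇒x≢y : ∀ {p : Subset n} {x y} → x ∈ p ∖ y → x ≢ y
x∈p∖y⇒x≢y {p = p} {x = x} x∈p∖x refl = x∉p∖x p x x∈p∖x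

Elimination-delete : x ∈ S → Elimination ε S (suc m) → Elimination ε (S ∖ x) m
Elimination-delete {x = x} x∈S (step {w = w} w∈S w-simp rest) with w ≟ x
... | yes refl = rest
... | no w≢x with x∈p∧x≢y⇒x∈p-y x∈S (w≢x ∘ sym) | rest
...   | x∈S∖w | done empty = contradiction (x , x∈S∖w) empty
...   | x∈S∖w | rest@(step _ _ _) =
  step (x∈p∧x≢y⇒x∈p-y w∈S w≢x) (Simplicial-⊆ (p─q⊆p _ _) w-simp)
    (subst (λ T → Elimination _ T _) (p─x─y≡p─y─x _ w x) (Elimination-delete x∈S∖w rest))

module _ {ε : SignMap n} {ν : Fin n → Fin n} (ordering : IsSignedElimOrdering ε ν) where

  private
    ν-injective : ∀ {x y} → ν x ≡ ν y → x ≡ y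
    ν-injective = proj₁ (proj₁ ordering)

    ν-surjective : ∀ r → ∃ λ x → ∀ {z} → z ≡ x → ν z ≡ r
    ν-surjective = proj₂ (proj₁ ordering)

    ν-condition : i ≢ j → i ≢ k → j ≢ k → ν i Fin.< ν k → ν j Fin.< ν k → ElimCondition ε i j k
    ν-condition i≢j i≢k j≢k i<k j<k =
      let c₁ , c₂ = proj₂ ordering _ _ _ i≢j i≢k j≢k i<k j<k in c₁ , c₂

  ranked-below : ℕ → Subset n
  ranked-below m = tabulate λ x → toℕ (ν x) ℕ.<ᵇ m

  ∈-ranked-below⁺ : toℕ (ν x) ℕ.< m → x ∈ ranked-below m
  ∈-ranked-below⁺ {x} r<m =
    lookup⇒[]= x _ (trans (lookup∘tabulate _ x) (Equivalence.to T-≡ (ℕ.<⇒<ᵇ r<m)))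

  ∈-ranked-below⁻ : x ∈ ranked-below m → toℕ (ν x) ℕ.< m
  ∈-ranked-below⁻ {x} x∈ =
    ℕ.<ᵇ⇒< _ _ (Equivalence.from T-≡ (trans (sym (lookup∘tabulate _ x)) ([]=⇒lookup x∈)))

  ordering⇒elimination : Elimination ε ⊤ n
  ordering⇒elimination = subst (λ S → Elimination ε S n) all-ranked-below (eliminate-below n ℕ.≤-refl)
    where
      all-ranked-below : ranked-below n ≡ ⊤
      all-ranked-below = ⊆-antisym (λ _ → ∈⊤) (λ _ → ∈-ranked-below⁺ (toℕ<n _))

      eliminate-below : ∀ m → m ℕ.≤ n → Elimination ε (ranked-below m) m
      eliminate-below zero    _   = done λ (_ , x∈) → ℕ.n≮0 (∈-ranked-below⁻ x∈)
      eliminate-below (suc m) m<n =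
        step (∈-ranked-below⁺ (ℕ.≤-reflexive (cong suc rank-top))) top-simplicial
          (subst (λ S → Elimination ε S m) (sym below∖top) (eliminate-below m (ℕ.<⇒≤ m<n)))
        where
          top : Fin n
          top = proj₁ (ν-surjective (fromℕ< m<n))
          rank-top : toℕ (ν top) ≡ m
          rank-top = trans (cong toℕ (proj₂ (ν-surjective (fromℕ< m<n)) refl)) (toℕ-fromℕ< m<n)

          rank-≢ : x ≢ top → toℕ (ν x) ≢ m
          rank-≢ x≢top r≡m = x≢top (ν-injective (toℕ-injective (trans r≡m (sym rank-top))))

          below-top : x ∈ ranked-below (suc m) → x ≢ top → toℕ (ν x) ℕ.< toℕ (ν top)
          below-top x∈ x≢top = subst (_ ℕ.<_) (sym rank-top)
            (ℕ.≤∧≢⇒< (ℕ.m<1+n⇒m≤n (∈-ranked-below⁻ x∈)) (rank-≢ x≢top))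

          top-simplicial : Simplicial ε (ranked-below (suc m)) top
          top-simplicial i∈ j∈ i≢j i≢top j≢top =
            ν-condition i≢j i≢top j≢top (below-top i∈ i≢top) (below-top j∈ j≢top)

          below∖top : ranked-below (suc m) ∖ top ≡ ranked-below m
          below∖top = ⊆-antisym
            (λ x∈ → ∈-ranked-below⁺ (ℕ.≤∧≢⇒< (ℕ.m<1+n⇒m≤n (∈-ranked-below⁻ (p─q⊆p _ _ x∈)))
                                             (rank-≢ (x∈p∖y⇒x≢y x∈))))
            (λ x∈ → x∈p∧x≢y⇒x∈p-y (∈-ranked-below⁺ (ℕ.m<n⇒m<1+n (∈-ranked-below⁻ x∈)))
                                   λ { refl → ℕ.<-irrefl rank-top (∈-ranked-below⁻ x∈) })

record Ranking (ε : SignMap n) (S : Subset n) (m : ℕ) : Set where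
  field
    rank            : Fin n → ℕ
    rank-<          : x ∈ S → rank x ℕ.< m
    rank-injective  : ∀ {x y} → x ∈ S → y ∈ S → rank x ≡ rank y → x ≡ y
    rank-surjective : ∀ {r} → r ℕ.< m → ∃ λ x → x ∈ S × rank x ≡ r
    rank-condition  : i ∈ S → j ∈ S → k ∈ S → i ≢ j → i ≢ k → j ≢ k →
                      rank i ℕ.< rank k → rank j ℕ.< rank k → ElimCondition ε i j k

ranking-empty : Empty S → Ranking ε S zero
ranking-empty empty = record
  { rank            = λ _ → 0
  ; rank-<          = λ x∈ → contradiction (_ , x∈) empty
  ; rank-injective  = λ x∈ → contradiction (_ , x∈) empty
  ; rank-surjective = λ ()
  ; rank-condition  = λ i∈ → contradiction (_ , i∈) empty
  }

ranking-step : w ∈ S → Simplicial ε S w → Ranking ε (S ∖ w) m → Ranking ε S (suc m)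
ranking-step {w = w} {S = S} {ε = ε} {m = m} w∈S w-simp ranking = record
  { rank = rank ; rank-< = rank-< ; rank-injective = rank-injective
  ; rank-surjective = rank-surjective ; rank-condition = rank-condition }
  where
    module R = Ranking ranking

    rank : Fin _ → ℕ
    rank x with x ≟ w
    ... | yes _ = m
    ... | no  _ = R.rank x

    rank-w : rank w ≡ m
    rank-w with w ≟ w
    ... | yes _   = refl
    ... | no  w≢w = contradiction refl w≢w

    rank-≢ : x ≢ w → rank x ≡ R.rank x
    rank-≢ {x} x≢w with x ≟ w
    ... | yes x≡w = contradiction x≡w x≢w
    ... | no  _   = refl

    ∈S∖w : x ∈ S → x ≢ w → x ∈ S ∖ w
    ∈S∖w = x∈p∧x≢y⇒x∈p-y

    rank-< : x ∈ S → rank x ℕ.< suc m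
    rank-< {x} x∈S with x ≟ w
    ... | yes _   = ℕ.n<1+n m
    ... | no  x≢w = ℕ.m<n⇒m<1+n (R.rank-< (∈S∖w x∈S x≢w))

    rank-injective : ∀ {x y} → x ∈ S → y ∈ S → rank x ≡ rank y → x ≡ y
    rank-injective {x} {y} x∈S y∈S eq with x ≟ w | y ≟ w
    ... | yes x≡w | yes y≡w = trans x≡w (sym y≡w)
    ... | yes _   | no  y≢w = contradiction (sym eq) (ℕ.<⇒≢ (R.rank-< (∈S∖w y∈S y≢w)))
    ... | no  x≢w | yes _   = contradiction eq (ℕ.<⇒≢ (R.rank-< (∈S∖w x∈S x≢w)))
    ... | no  x≢w | no  y≢w = R.rank-injective (∈S∖w x∈S x≢w) (∈S∖w y∈S y≢w) eq

    rank-surjective : ∀ {r} → r ℕ.< suc m → ∃ λ x → x ∈ S × rank x ≡ r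
    rank-surjective r<1+m with ℕ.m<1+n⇒m<n∨m≡n r<1+m
    ... | inj₂ refl = w , w∈S , rank-w
    ... | inj₁ r<m with R.rank-surjective r<m
    ...   | x , x∈S∖w , eq =
      x , p─q⊆p _ _ x∈S∖w , trans (rank-≢ (x∈p∖y⇒x≢y x∈S∖w)) eq

    rank-condition : i ∈ S → j ∈ S → k ∈ S → i ≢ j → i ≢ k → j ≢ k →
                     rank i ℕ.< rank k → rank j ℕ.< rank k → ElimCondition ε i j k
    rank-condition {i} {j} {k} i∈S j∈S k∈S i≢j i≢k j≢k i<k j<k with k ≟ w
    ... | yes refl = w-simp i∈S j∈S i≢j i≢k j≢k
    ... | no  k≢w  =
      R.rank-condition (∈S∖w i∈S i≢w) (∈S∖w j∈S j≢w) (∈S∖w k∈S k≢w) i≢j i≢k j≢k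
        (subst (ℕ._< R.rank k) (rank-≢ i≢w) i<k) (subst (ℕ._< R.rank k) (rank-≢ j≢w) j<k)
      where
        below-k-≢w : rank x ℕ.< R.rank k → x ≢ w
        below-k-≢w x<k refl =
          ℕ.<-asym (subst (ℕ._< R.rank k) rank-w x<k) (R.rank-< (∈S∖w k∈S k≢w))
        i≢w : i ≢ w
        i≢w = below-k-≢w i<k
        j≢w : j ≢ w
        j≢w = below-k-≢w j<k

elimination⇒ranking : Elimination ε S m → Ranking ε S m
elimination⇒ranking (done empty)           = ranking-empty empty
elimination⇒ranking (step w∈S w-simp rest) = ranking-step w∈S w-simp (elimination⇒ranking rest)

elimination⇒ordering : ∀ {n} {ε : SignMap n} → Elimination ε ⊤ n → SignedEliminable ε
elimination⇒ordering {n = n} {ε = ε} elimination =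
  ν , (ν-injective , ν-surjective) , λ i j k i≢j i≢k j≢k i<k j<k →
    let c = ν-condition i j k i≢j i≢k j≢k i<k j<k in closure c , balance c
  where
    open Ranking (elimination⇒ranking elimination)

    ν : Fin n → Fin n
    ν x = fromℕ< (rank-< ∈⊤)

    toℕ-ν : ∀ x → toℕ (ν x) ≡ rank x
    toℕ-ν x = toℕ-fromℕ< (rank-< ∈⊤)

    ν-injective : ∀ {x y} → ν x ≡ ν y → x ≡ y
    ν-injective {x} {y} eq = rank-injective ∈⊤ ∈⊤ (trans (sym (toℕ-ν x)) (trans (cong toℕ eq) (toℕ-ν y)))

    ν-surjective : ∀ r → ∃ λ x → ∀ {z} → z ≡ x → ν z ≡ r
    ν-surjective r with rank-surjective (toℕ<n r)
    ... | x , _ , eq = x , λ { refl → toℕ-injective (trans (toℕ-ν x) eq) }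

    ν-condition : ∀ i j k → i ≢ j → i ≢ k → j ≢ k → ν i Fin.< ν k → ν j Fin.< ν k →
                  ElimCondition ε i j k
    ν-condition i j k i≢j i≢k j≢k i<k j<k =
      rank-condition ∈⊤ ∈⊤ ∈⊤ i≢j i≢k j≢k
        (subst₂ ℕ._<_ (toℕ-ν i) (toℕ-ν k) i<k) (subst₂ ℕ._<_ (toℕ-ν j) (toℕ-ν k) j<k)

SignedEliminable⇔Elimination : ∀ {n} {ε : SignMap n} → SignedEliminable ε ⇔ Elimination ε ⊤ n
SignedEliminable⇔Elimination = mk⇔ (λ (_ , ordering) → ordering⇒elimination ordering) elimination⇒ordering

PositiveClique : SignMap n → Subset n → Pred (Fin n) 0ℓ → Set
PositiveClique ε S P = ∀ {x y} → x ∈ S → y ∈ S → x ≢ y → P x → P y → Edge ε + x y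

NoNegativeEdgeFrom : SignMap n → Subset n → Pred (Fin n) 0ℓ → Set
NoNegativeEdgeFrom ε S P = ∀ {x} → x ∈ S → P x → ∀ {y} → y ∈ S → x ≢ y → ¬ Edge ε - x y

module _ {ε : SignMap n} (ε-sym : Symmetric ε) where

  positive-simplicial : (∀ {x y} → x ∈ S → y ∈ S → x ≢ y → Edge ε + x y) → w ∈ S → Simplicial ε S w
  positive-simplicial positive w∈S i∈S j∈S i≢j i≢w _ =
    (λ { + _ _ → positive i∈S j∈S i≢j
       ; - p _ → contradiction (trans (sym p) (positive i∈S w∈S i≢w)) λ () }) ,
    (λ { + _ q → contradiction (trans (sym q) (positive i∈S j∈S i≢j)) λ ()
       ; - p _ → contradiction (trans (sym p) (positive w∈S i∈S (i≢w ∘ sym))) λ () })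

  module _ (k-simp : Simplicial ε S k) where

    positive-neighbours-clique : PositiveClique ε (S ∖ k) (Edge ε + k)
    positive-neighbours-clique x∈ y∈ x≢y k⁺x k⁺y =
      closure (k-simp (p─q⊆p _ _ x∈) (p─q⊆p _ _ y∈) x≢y (x∈p∖y⇒x≢y x∈) (x∈p∖y⇒x≢y y∈))
        + (trans (ε-sym _ k) k⁺x) (trans (ε-sym _ k) k⁺y)

    positive-neighbours-nonnegative : (∀ {y} → y ∈ S → k ≢ y → ¬ Edge ε - k y) →
                                      NoNegativeEdgeFrom ε (S ∖ k) (Edge ε + k)
    positive-neighbours-nonnegative k-nonneg x∈ k⁺x y∈ x≢y x⁻y =
      k-nonneg (p─q⊆p _ _ y∈) (x∈p∖y⇒x≢y y∈ ∘ sym)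
        (balance (k-simp (p─q⊆p _ _ x∈) (p─q⊆p _ _ y∈) x≢y (x∈p∖y⇒x≢y x∈) (x∈p∖y⇒x≢y y∈)) + k⁺x x⁻y)

    simplicial-insert : ∀ {w} → (∀ {y} → y ∈ S → k ≢ y → ¬ Edge ε - k y) →
                        (∀ σ → ¬ Edge ε σ k w) → w ∈ S ∖ k → Simplicial ε (S ∖ k) w → Simplicial ε S w
    simplicial-insert {w} k-nonneg k≁w w∈ w-simp {i} {j} i∈S j∈S i≢j i≢w j≢w with i ≟ k | j ≟ k
    ... | yes refl | yes refl = contradiction refl i≢j
    ... | yes refl | no  _    = (λ σ p _ → ⊥-elim (k≁w σ p)) , (λ σ p _ → ⊥-elim (k≁w σ (trans (ε-sym k w) p)))
    ... | no  i≢k  | yes refl = (λ σ _ q → ⊥-elim (k≁w σ q)) , λ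
      { + _ q → ⊥-elim (k-nonneg i∈S (i≢k ∘ sym) (trans (ε-sym k i) q))
      ; - p q → ⊥-elim (positive-neighbours-nonnegative k-nonneg (x∈p∧x≢y⇒x∈p-y i∈S i≢k)
                          (trans (ε-sym k i) q) w∈ i≢w (trans (ε-sym i w) p)) }
    ... | no  i≢k  | no  j≢k  = w-simp (x∈p∧x≢y⇒x∈p-y i∈S i≢k) (x∈p∧x≢y⇒x∈p-y j∈S j≢k) i≢j i≢w j≢w

  -- Dirac's lemma for signed graphs: the simplicial vertices cannot all lie in a positive clique
  -- without negative edges.
  simplicial-outside : ∀ {P x₀} → Decidable P → Elimination ε S m →
                       PositiveClique ε S P → NoNegativeEdgeFrom ε S P → x₀ ∈ S → ¬ P x₀ →
                       ∃ λ w → w ∈ S × ¬ P w × Simplicial ε S w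
  simplicial-outside P? (done empty) _ _ x₀∈S _ = contradiction (_ , x₀∈S) empty
  simplicial-outside {S = S} {x₀ = x₀} P? (step {w = k} k∈S k-simp rest) clique nonneg x₀∈S ¬Px₀
    with P? k
  ... | no ¬Pk = k , k∈S , ¬Pk , k-simp
  ... | yes Pk with any? (λ x → x ∈? S ∖ k ×-dec ¬? (≟plus (ε k x)))
  ...   | no all-positive = x₀ , x₀∈S , ¬Px₀ , positive-simplicial positive x₀∈S
    where
      k⁺ : x ∈ S → x ≢ k → Edge ε + k x
      k⁺ {x} x∈S x≢k with ≟plus (ε k x)
      ... | yes k⁺x  = k⁺x
      ... | no  ¬k⁺x = contradiction (x , x∈p∧x≢y⇒x∈p-y x∈S x≢k , ¬k⁺x) all-positive

      positive : ∀ {x y} → x ∈ S → y ∈ S → x ≢ y → Edge ε + x y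
      positive {x} {y} x∈S y∈S x≢y with x ≟ k | y ≟ k
      ... | yes refl | yes refl = contradiction refl x≢y
      ... | yes refl | no  y≢k  = k⁺ y∈S y≢k
      ... | no  x≢k  | yes refl = trans (ε-sym x k) (k⁺ x∈S x≢k)
      ... | no  x≢k  | no  y≢k  = positive-neighbours-clique k-simp
            (x∈p∧x≢y⇒x∈p-y x∈S x≢k) (x∈p∧x≢y⇒x∈p-y y∈S y≢k) x≢y (k⁺ x∈S x≢k) (k⁺ y∈S y≢k)
  ...   | yes (x₁ , x₁∈S∖k , ¬k⁺x₁)
    with simplicial-outside (≟plus ∘ ε k) rest (positive-neighbours-clique k-simp)
           (positive-neighbours-nonnegative k-simp (nonneg k∈S Pk)) x₁∈S∖k ¬k⁺x₁
  ...     | w , w∈S∖k , ¬k⁺w , w-simp =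
    w , w∈S , (¬k⁺w ∘ clique k∈S w∈S k≢w Pk) ,
    simplicial-insert k-simp (nonneg k∈S Pk) k≁w w∈S∖k w-simp
    where
      w∈S : w ∈ S
      w∈S = p─q⊆p _ _ w∈S∖k
      k≢w : k ≢ w
      k≢w = x∈p∖y⇒x≢y w∈S∖k ∘ sym
      k≁w : ∀ σ → ¬ Edge ε σ k w
      k≁w + = ¬k⁺w
      k≁w - = nonneg k∈S Pk w∈S k≢w

lowerAt-outside : i ≢ v → j ≢ v → lowerAt v ε i j ≡ ε i j
lowerAt-outside {i = i} {v = v} {j = j} i≢v j≢v with i ≟ v | j ≟ v
... | yes i≡v | _       = contradiction i≡v i≢v
... | no  _   | yes j≡v = contradiction j≡v j≢v
... | no  _   | no  _   = refl

lowerAt-left : j ≢ v → lowerAt v ε v j ≡ dec (ε v j)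
lowerAt-left {j = j} {v = v} j≢v with v ≟ v | j ≟ v
... | no  v≢v | _       = contradiction refl v≢v
... | yes _   | yes j≡v = contradiction j≡v j≢v
... | yes _   | no  _   = refl

lowerAt-right : i ≢ v → lowerAt v ε i v ≡ dec (ε i v)
lowerAt-right {i = i} {v = v} i≢v with i ≟ v | v ≟ v
... | _       | no  v≢v = contradiction refl v≢v
... | yes i≡v | yes _   = contradiction i≡v i≢v
... | no  _   | yes _   = refl

lowerAt-symmetric : Symmetric ε → Symmetric (lowerAt v ε)
lowerAt-symmetric {ε = ε} {v = v} ε-sym i j with i ≟ v | j ≟ v
... | yes _ | yes _ = ε-sym i j
... | yes _ | no  _ = cong dec (ε-sym i j)
... | no  _ | yes _ = cong dec (ε-sym i j)
... | no  _ | no  _ = ε-sym i j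

lowerAt-triangle : w ≢ v → i ≢ j →
                   Triangle (ε i j) (ε i w) (ε j w) → Triangle (ε i j) (ε j w) (ε i w) →
                   Dec (i ≡ v) → Dec (j ≡ v) →
                   Triangle (lowerAt v ε i j) (lowerAt v ε i w) (lowerAt v ε j w)
lowerAt-triangle _   i≢j _ _ (yes refl) (yes refl) = contradiction refl i≢j
lowerAt-triangle w≢v _   t t′ (yes refl) (no j≢v) =
  Triangle-cong (sym (lowerAt-left j≢v)) (sym (lowerAt-left w≢v)) (sym (lowerAt-outside j≢v w≢v))
    (proj₁ (lower-triangle t t′))
lowerAt-triangle w≢v _   t t′ (no i≢v) (yes refl) =
  Triangle-cong (sym (lowerAt-right i≢v)) (sym (lowerAt-outside i≢v w≢v)) (sym (lowerAt-left w≢v))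
    (proj₂ (lower-triangle t′ t))
lowerAt-triangle w≢v _   t _  (no i≢v) (no j≢v) =
  Triangle-cong (sym (lowerAt-outside i≢v j≢v)) (sym (lowerAt-outside i≢v w≢v))
    (sym (lowerAt-outside j≢v w≢v)) t

lower-simplicial : Symmetric ε → w ≢ v → Simplicial ε S w → Simplicial (lowerAt v ε) S w
lower-simplicial {ε = ε} {w = w} {v = v} ε-sym w≢v w-simp {i} {j} i∈S j∈S i≢j i≢w j≢w =
  triangle⇒condition (lowerAt-symmetric ε-sym) (lowerAt-triangle w≢v i≢j t t′ (i ≟ v) (j ≟ v))
  where
    t : Triangle (ε i j) (ε i w) (ε j w)
    t = condition⇒triangle ε-sym (w-simp i∈S j∈S i≢j i≢w j≢w)
    t′ : Triangle (ε i j) (ε j w) (ε i w)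
    t′ = Triangle-cong (ε-sym j i) refl refl
           (condition⇒triangle ε-sym (w-simp j∈S i∈S (i≢j ∘ sym) j≢w i≢w))

NonNegativeAt : Fin n → SignMap n → Set
NonNegativeAt v ε = ∀ i → i ≢ v → ε i v ≢ minus

module _ {ε : SignMap n} {v : Fin n} (ε-sym : Symmetric ε) (v-nonneg : NonNegativeAt v ε) where

  simplicial-avoiding : Elimination ε S m → x ∈ S → x ≢ v → ∃ λ w → w ∈ S × w ≢ v × Simplicial ε S w
  simplicial-avoiding elimination x∈S x≢v =
    simplicial-outside ε-sym (_≟ v) elimination
      (λ _ _ x≢y x≡v y≡v → contradiction (trans x≡v (sym y≡v)) x≢y)
      (λ { _ refl y∈S v≢y v⁻y → v-nonneg _ (v≢y ∘ sym) (trans (ε-sym _ v) v⁻y) })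
      x∈S x≢v

  lower-elimination : Elimination ε S m → Elimination (lowerAt v ε) S m
  lower-elimination (done empty) = done empty
  lower-elimination {S = S} elimination@(step {w = w} w∈S w-simp rest) with w ≟ v
  ... | no w≢v = step w∈S (lower-simplicial ε-sym w≢v w-simp) (lower-elimination rest)
  ... | yes refl with any? (λ x → x ∈? S ×-dec ¬? (x ≟ v))
  ...   | no only-v =
    step w∈S (λ i∈S _ _ i≢v _ → contradiction (_ , i∈S , i≢v) only-v) (lower-elimination rest)
  ...   | yes (x , x∈S , x≢v) with simplicial-avoiding elimination x∈S x≢v
  ...     | u , u∈S , u≢v , u-simp =
    step u∈S (lower-simplicial ε-sym u≢v u-simp) (lower-elimination (Elimination-delete u∈S elimination))

  lowerAt-eliminable : SignedEliminable ε → SignedEliminable (lowerAt v ε)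
  lowerAt-eliminable =
    Equivalence.from SignedEliminable⇔Elimination ∘ lower-elimination ∘ Equivalence.to SignedEliminable⇔Elimination

lowerAt-centre : lowerAt v ε v v ≡ ε v v
lowerAt-centre {v = v} with v ≟ v
... | yes _   = refl
... | no  v≢v = contradiction refl v≢v

dec-opposite-dec : a ≢ minus → dec (opposite (dec a)) ≡ opposite a
dec-opposite-dec {plus}  _        = refl
dec-opposite-dec {zer}   _        = refl
dec-opposite-dec {minus} a≢minus = contradiction refl a≢minus

lowerAt-opposite-lowerAt : Symmetric ε → NonNegativeAt v ε →
                           ∀ i j → lowerAt v (opposite ∘₂ lowerAt v ε) i j ≡ opposite (ε i j)
lowerAt-opposite-lowerAt {ε = ε} {v = v} ε-sym v-nonneg i j = by-cases (i ≟ v) (j ≟ v)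
  where
    open ≡-Reasoning

    by-cases : ∀ {i j} → Dec (i ≡ v) → Dec (j ≡ v) →
               lowerAt v (opposite ∘₂ lowerAt v ε) i j ≡ opposite (ε i j)
    by-cases (yes refl) (yes refl) =
      trans (lowerAt-centre {v = v} {ε = opposite ∘₂ lowerAt v ε}) (cong opposite (lowerAt-centre {ε = ε}))
    by-cases {j = j} (yes refl) (no j≢v) = begin
      lowerAt v (opposite ∘₂ lowerAt v ε) v j ≡⟨ lowerAt-left j≢v ⟩
      dec (opposite (lowerAt v ε v j))        ≡⟨ cong (dec ∘ opposite) (lowerAt-left j≢v) ⟩
      dec (opposite (dec (ε v j)))            ≡⟨ dec-opposite-dec (v-nonneg j j≢v ∘ trans (ε-sym j v)) ⟩
      opposite (ε v j)                        ∎
    by-cases {i = i} (no i≢v) (yes refl) = begin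
      lowerAt v (opposite ∘₂ lowerAt v ε) i v ≡⟨ lowerAt-right i≢v ⟩
      dec (opposite (lowerAt v ε i v))        ≡⟨ cong (dec ∘ opposite) (lowerAt-right i≢v) ⟩
      dec (opposite (dec (ε i v)))            ≡⟨ dec-opposite-dec (v-nonneg i i≢v) ⟩
      opposite (ε i v)                        ∎
    by-cases (no i≢v) (no j≢v) =
      trans (lowerAt-outside i≢v j≢v) (cong opposite (lowerAt-outside i≢v j≢v))

SignedEliminable-map : (∀ {i j k} → ElimCondition ε i j k → ElimCondition ε′ i j k) →
                 SignedEliminable ε → SignedEliminable ε′
SignedEliminable-map f (ν , ν-bijective , ν-condition) =
  ν , ν-bijective , λ i j k i≢j i≢k j≢k i<k j<k →
    let c₁ , c₂ = ν-condition i j k i≢j i≢k j≢k i<k j<k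
        c = f (c₁ , c₂)
    in  closure c , balance c

proposition4p6 : (n : ℕ) (v : Fin n) (ε : Fin n → Fin n → Sign) →
    Symmetric ε →
    (∀ i → ¬ i ≡ v → ¬ ε i v ≡ minus) →
    SignedEliminable ε ⇔ SignedEliminable (lowerAt v ε)
proposition4p6 n v ε ε-sym v-nonneg = mk⇔ (lowerAt-eliminable ε-sym v-nonneg) raise
  where
    ε⁻ : SignMap n
    ε⁻ = opposite ∘₂ lowerAt v ε

    ε⁻-nonneg : NonNegativeAt v ε⁻
    ε⁻-nonneg i i≢v eq = dec≢plus (trans (sym (lowerAt-right {ε = ε} i≢v)) (opposite⁻ - eq))

    lowered-ε⁻-condition : ∀ {i j k} → ElimCondition (lowerAt v ε⁻) i j k → ElimCondition ε i j k
    lowered-ε⁻-condition =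
      condition-cong (opposite-involutive ∘₂ ε) ∘ condition-opposite
      ∘ condition-cong (lowerAt-opposite-lowerAt ε-sym v-nonneg)

    raise : SignedEliminable (lowerAt v ε) → SignedEliminable ε
    raise =
      SignedEliminable-map lowered-ε⁻-condition
      ∘ lowerAt-eliminable {ε = ε⁻} (cong opposite ∘₂ lowerAt-symmetric ε-sym) ε⁻-nonneg
      ∘ SignedEliminable-map condition-opposite
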